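{- Let $n\ge 3$, let $\mathcal I$ be a finite multiset of intervals on the points $\{1,\dots,n-1\}$, let $L=\{1,\dots,\lceil\frac{n-1}{2}\rceil\}$, $R=\{\lceil\frac{n-1}{2}\rceil+1,\dots,n-1\}$, and let $M$ be the $|L|\times|R|$ matrix whose row $k$ corresponds to the point $\ell_k=\lceil\frac{n-1}{2}\rceil-k+1$ and whose columns are indexed by $j\in R$ in increasing order, with $M(k,j)=\mathsf{Cost}(\ell_k,j)$. Fix a column $j\in R$, and let $i_s$ be the smallest and $i_t$ ($\ge i_s$) the largest row index $k$ at which $M(k,j)=\min_{k'}M(k',j)$. Then for every column $j'\in R$ with $j'<j$ there is a row $k\in\{1,\dots,i_s\}$ with $M(k,j')=\min_{k'}M(k',j')$, and for every column $j''\in R$ with $j''>j$ there is a row $k\in\{i_t,\dots,|L|\}$ with $M(k,j'')=\min_{k'}M(k',j'')$.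
   Context: An interval is a pair $(s,t)$ of integers with $1\le s\le t\le n-1$; it covers a point $i$ if $s\le i\le t$. For points $i,j$, $\mathsf{Cost}(i,j)$ is the number of intervals in $\mathcal I$ (counted with multiplicity) that cover exactly one of $i$ and $j$. The rows of $M$ are ordered by decreasing point of $L$. -}

module Defs where

open import Data.Nat using (ℕ; zero; suc; _+_; _∸_; _≤_; _<_; _≤ᵇ_; ⌈_/2⌉)
open import Data.Bool using (Bool; true; false; _∧_; _xor_)
open import Data.Product using (_×_; _,_)
open import Data.List using (List; []; _∷_)

Interval : Set
Interval = ℕ × ℕ

ValidInterval : ℕ → Interval → Set
ValidInterval n (s , t) = 1 ≤ s × s ≤ t × t ≤ n ∸ 1

covers : Interval → ℕ → Bool
covers (s , t) i = (s ≤ᵇ i) ∧ (i ≤ᵇ t)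

Cost : List Interval → ℕ → ℕ → ℕ
Cost [] i j = 0
Cost (x ∷ I) i j with covers x i xor covers x j
... | true  = suc (Cost I i j)
... | false = Cost I i j

-- h = ⌈(n-1)/2⌉ = |L|;  L = {1..h},  R = {h+1 .. n-1}
half : ℕ → ℕ
half n = ⌈ n ∸ 1 /2⌉

rowPoint : ℕ → ℕ → ℕ
rowPoint n k = half n ∸ k + 1

M : ℕ → List Interval → ℕ → ℕ → ℕ
M n I k j = Cost I (rowPoint n k) j

IsRow : ℕ → ℕ → Set
IsRow n k = 1 ≤ k × k ≤ half n

InR : ℕ → ℕ → Set
InR n j = half n < j × j ≤ n ∸ 1

IsColMin : ℕ → List Interval → ℕ → ℕ → Set
IsColMin n I k j = IsRow n k × (∀ k' → IsRow n k' → M n I k j ≤ M n I k' j)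

-- Cost(·,·) is a sum, over the intervals, of the indicator that an interval separates two
-- points. Because an interval covers a contiguous set of points, each such indicator
-- satisfies the Monge inequality on points l₁ ≤ l₂ ≤ j₁ ≤ j₂, and hence so does Cost.
-- Rows of M list the points of L in decreasing order and every point of L lies left of
-- every point of R, so M is a Monge matrix. In a Monge matrix a column minimum in one
-- column can be exchanged for one in any other column, which pushes the minima of
-- earlier columns upwards and those of later columns downwards.
module Submission where

open import Defs
open import Data.Nat using (ℕ; zero; suc; _+_; _≤_; _<_; _≤ᵇ_; z≤n; s≤s; _≤?_)
open import Data.Nat.Properties
open import Data.Bool using (Bool; true; false; _∧_; _xor_; T)
open import Data.Bool.Properties using (T-∧)
open import Data.Empty using (⊥-elim)
open import Data.Product using (_×_; ∃; _,_)
open import Data.Sum using (inj₁; inj₂)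
open import Data.List using (List; []; _∷_)
open import Data.List.Relation.Unary.All using (All)
open import Function.Bundles using (Equivalence)
open import Relation.Binary.PropositionalEquality using (_≡_; refl; cong; cong₂)
open import Relation.Nullary using (yes; no)
open import Algebra.Properties.CommutativeSemigroup +-commutativeSemigroup using (interchange)

toℕ : Bool → ℕ
toℕ true  = 1
toℕ false = 0

-- The inequality fails only for the patterns 1010 and 0101, excluded by the two hypotheses.
xor-monge : ∀ b₁ b₂ b₃ b₄ → (T (b₁ ∧ b₃) → T b₂) → (T (b₂ ∧ b₄) → T b₃) →
  toℕ (b₂ xor b₃) + toℕ (b₁ xor b₄) ≤ toℕ (b₁ xor b₃) + toℕ (b₂ xor b₄)
xor-monge true  false true  _     gap _   = ⊥-elim (gap _)
xor-monge _     true  false true  _   gap = ⊥-elim (gap _)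
xor-monge true  true  true  true  _ _ = ≤ᵇ⇒≤ _ _ _
xor-monge true  true  true  false _ _ = ≤ᵇ⇒≤ _ _ _
xor-monge true  true  false false _ _ = ≤ᵇ⇒≤ _ _ _
xor-monge true  false false true  _ _ = ≤ᵇ⇒≤ _ _ _
xor-monge true  false false false _ _ = ≤ᵇ⇒≤ _ _ _
xor-monge false true  true  true  _ _ = ≤ᵇ⇒≤ _ _ _
xor-monge false true  true  false _ _ = ≤ᵇ⇒≤ _ _ _
xor-monge false true  false false _ _ = ≤ᵇ⇒≤ _ _ _
xor-monge false false true  true  _ _ = ≤ᵇ⇒≤ _ _ _
xor-monge false false true  false _ _ = ≤ᵇ⇒≤ _ _ _
xor-monge false false false true  _ _ = ≤ᵇ⇒≤ _ _ _
xor-monge false false false false _ _ = ≤ᵇ⇒≤ _ _ _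

covers-sound : ∀ {s t i} → T (covers (s , t) i) → s ≤ i × i ≤ t
covers-sound {s} {t} {i} covered with Equivalence.to (T-∧ {s ≤ᵇ i}) covered
... | s≤ᵇi , i≤ᵇt = ≤ᵇ⇒≤ s i s≤ᵇi , ≤ᵇ⇒≤ i t i≤ᵇt

covers-complete : ∀ {s t i} → s ≤ i × i ≤ t → T (covers (s , t) i)
covers-complete (s≤i , i≤t) = Equivalence.from T-∧ (≤⇒≤ᵇ s≤i , ≤⇒≤ᵇ i≤t)

covers-between : ∀ x {p q r} → p ≤ q → q ≤ r → T (covers x p ∧ covers x r) → T (covers x q)
covers-between (s , t) {p} {q} {r} p≤q q≤r covered
  with Equivalence.to (T-∧ {covers (s , t) p}) covered
... | covers-p , covers-r with covers-sound {s} {t} covers-p | covers-sound {s} {t} covers-r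
...   | s≤p , _ | _ , r≤t = covers-complete (≤-trans s≤p p≤q , ≤-trans q≤r r≤t)

separates : Interval → ℕ → ℕ → Bool
separates x i j = covers x i xor covers x j

separates-monge : ∀ x {l₁ l₂ j₁ j₂} → l₁ ≤ l₂ → l₂ ≤ j₁ → j₁ ≤ j₂ →
  toℕ (separates x l₂ j₁) + toℕ (separates x l₁ j₂) ≤
  toℕ (separates x l₁ j₁) + toℕ (separates x l₂ j₂)
separates-monge x {l₁} {l₂} {j₁} {j₂} l₁≤l₂ l₂≤j₁ j₁≤j₂ =
  xor-monge (covers x l₁) (covers x l₂) (covers x j₁) (covers x j₂)
    (covers-between x l₁≤l₂ l₂≤j₁) (covers-between x l₂≤j₁ j₁≤j₂)

Cost-∷ : ∀ x I i j → Cost (x ∷ I) i j ≡ toℕ (separates x i j) + Cost I i j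
Cost-∷ x I i j with covers x i xor covers x j
... | true  = refl
... | false = refl

Cost-monge : ∀ I {l₁ l₂ j₁ j₂} → l₁ ≤ l₂ → l₂ ≤ j₁ → j₁ ≤ j₂ →
  Cost I l₂ j₁ + Cost I l₁ j₂ ≤ Cost I l₁ j₁ + Cost I l₂ j₂
Cost-monge [] _ _ _ = z≤n
Cost-monge (x ∷ I) {l₁} {l₂} {j₁} {j₂} l₁≤l₂ l₂≤j₁ j₁≤j₂ = begin
  Cost (x ∷ I) l₂ j₁ + Cost (x ∷ I) l₁ j₂
    ≡⟨ cong₂ _+_ (Cost-∷ x I l₂ j₁) (Cost-∷ x I l₁ j₂) ⟩
  (σ l₂ j₁ + Cost I l₂ j₁) + (σ l₁ j₂ + Cost I l₁ j₂)
    ≡⟨ interchange (σ l₂ j₁) (Cost I l₂ j₁) (σ l₁ j₂) (Cost I l₁ j₂) ⟩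
  (σ l₂ j₁ + σ l₁ j₂) + (Cost I l₂ j₁ + Cost I l₁ j₂)
    ≤⟨ +-mono-≤ (separates-monge x l₁≤l₂ l₂≤j₁ j₁≤j₂) (Cost-monge I l₁≤l₂ l₂≤j₁ j₁≤j₂) ⟩
  (σ l₁ j₁ + σ l₂ j₂) + (Cost I l₁ j₁ + Cost I l₂ j₂)
    ≡⟨ interchange (σ l₁ j₁) (σ l₂ j₂) (Cost I l₁ j₁) (Cost I l₂ j₂) ⟩
  (σ l₁ j₁ + Cost I l₁ j₁) + (σ l₂ j₂ + Cost I l₂ j₂)
    ≡⟨ cong₂ _+_ (Cost-∷ x I l₁ j₁) (Cost-∷ x I l₂ j₂) ⟨
  Cost (x ∷ I) l₁ j₁ + Cost (x ∷ I) l₂ j₂ ∎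
  where
  open ≤-Reasoning
  σ : ℕ → ℕ → ℕ
  σ i j = toℕ (separates x i j)

Monge : (ℕ → ℕ → ℕ) → ℕ → ℕ → Set
Monge A j₁ j₂ = ∀ {k k′} → k ≤ k′ → A k j₁ + A k′ j₂ ≤ A k′ j₁ + A k j₂

rowPoint-antitone : ∀ n {k k′} → k ≤ k′ → rowPoint n k′ ≤ rowPoint n k
rowPoint-antitone n k≤k′ = +-monoˡ-≤ 1 (∸-monoʳ-≤ (half n) k≤k′)

-- Holds for every k, not only for rows: truncated subtraction keeps rowPoint n k ≤ half n + 1.
rowPoint≤R : ∀ n k {j} → half n < j → rowPoint n k ≤ j
rowPoint≤R n k h<j =
  ≤-trans (+-monoˡ-≤ 1 (m∸n≤m (half n) k)) (≤-trans (≤-reflexive (+-comm (half n) 1)) h<j)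

M-monge : ∀ n I {j₁ j₂} → half n < j₁ → j₁ ≤ j₂ → Monge (M n I) j₁ j₂
M-monge n I h<j₁ j₁≤j₂ {k} k≤k′ = Cost-monge I (rowPoint-antitone n k≤k′) (rowPoint≤R n k h<j₁) j₁≤j₂

Between : ℕ → ℕ → ℕ → Set
Between a b k = a ≤ k × k ≤ b

Minimizes : (ℕ → ℕ) → ℕ → ℕ → ℕ → Set
Minimizes f a b k = Between a b k × (∀ k′ → Between a b k′ → f k ≤ f k′)

lower-bound-extend : ∀ (f : ℕ → ℕ) {a b c} → (∀ k → Between a b k → c ≤ f k) → c ≤ f (suc b) →
  ∀ k → Between a (suc b) k → c ≤ f k
lower-bound-extend f below top k (a≤k , k≤1+b) with m≤n⇒m<n∨m≡n k≤1+b
... | inj₁ (s≤s k≤b) = below k (a≤k , k≤b)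
... | inj₂ refl      = top

argmin-exists : ∀ (f : ℕ → ℕ) {a b} → a ≤ b → ∃ (Minimizes f a b)
argmin-exists f {b = zero} z≤n = zero , (z≤n , z≤n) , λ { _ (z≤n , z≤n) → ≤-refl }
argmin-exists f {a} {suc b} a≤1+b with m≤n⇒m<n∨m≡n a≤1+b
... | inj₂ refl = suc b , (≤-refl , ≤-refl) , λ k (1+b≤k , k≤1+b) → ≤-reflexive (cong f (≤-antisym 1+b≤k k≤1+b))
... | inj₁ (s≤s a≤b) with argmin-exists f a≤b
...   | k , (a≤k , k≤b) , k-min with ≤-total (f k) (f (suc b))
...     | inj₁ fk≤ = k , (a≤k , m≤n⇒m≤1+n k≤b) , lower-bound-extend f k-min fk≤
...     | inj₂ ≤fk = suc b , (a≤1+b , ≤-refl) ,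
                     lower-bound-extend f (λ k′ r → ≤-trans ≤fk (k-min k′ r)) ≤-refl

m+n≤o+p⇒p≤n⇒m≤o : ∀ {m n o p} → m + n ≤ o + p → p ≤ n → m ≤ o
m+n≤o+p⇒p≤n⇒m≤o {m} {n} {o} le p≤n = +-cancelʳ-≤ n m o (≤-trans le (+-monoʳ-≤ o p≤n))

m+n≤o+p⇒o≤m⇒n≤p : ∀ {m n o p} → m + n ≤ o + p → o ≤ m → n ≤ p
m+n≤o+p⇒o≤m⇒n≤p {m} {n} {o} {p} le o≤m = +-cancelˡ-≤ m n p (≤-trans le (+-monoˡ-≤ p o≤m))

module _ {A : ℕ → ℕ → ℕ} {j₁ j₂} (monge : Monge A j₁ j₂) {a b : ℕ} where

  column-min-above : ∀ {i} → Minimizes (λ k → A k j₂) a b i →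
    ∃ λ k → k ≤ i × Minimizes (λ k → A k j₁) a b k
  column-min-above {i} ((a≤i , i≤b) , i-min) with argmin-exists (λ k → A k j₁) a≤i
  ... | k , (a≤k , k≤i) , k-min = k , k≤i , (a≤k , ≤-trans k≤i i≤b) , minimal
    where
    minimal : ∀ k′ → Between a b k′ → A k j₁ ≤ A k′ j₁
    minimal k′ (a≤k′ , k′≤b) with k′ ≤? i
    ... | yes k′≤i = k-min k′ (a≤k′ , k′≤i)
    ... | no  k′≰i = ≤-trans (k-min i (a≤i , ≤-refl))
      (m+n≤o+p⇒p≤n⇒m≤o (monge (<⇒≤ (≰⇒> k′≰i))) (i-min k′ (a≤k′ , k′≤b)))

  column-min-below : ∀ {i} → Minimizes (λ k → A k j₁) a b i →
    ∃ λ k → i ≤ k × Minimizes (λ k → A k j₂) a b k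
  column-min-below {i} ((a≤i , i≤b) , i-min) with argmin-exists (λ k → A k j₂) i≤b
  ... | k , (i≤k , k≤b) , k-min = k , i≤k , (≤-trans a≤i i≤k , k≤b) , minimal
    where
    minimal : ∀ k′ → Between a b k′ → A k j₂ ≤ A k′ j₂
    minimal k′ (a≤k′ , k′≤b) with i ≤? k′
    ... | yes i≤k′ = k-min k′ (i≤k′ , k′≤b)
    ... | no  i≰k′ = ≤-trans (k-min i (≤-refl , i≤b))
      (m+n≤o+p⇒o≤m⇒n≤p (monge (<⇒≤ (≰⇒> i≰k′))) (i-min k′ (a≤k′ , k′≤b)))

claim3p4 : (n : ℕ) → 3 ≤ n → (I : List Interval) → All (ValidInterval n) I →
    (j : ℕ) → InR n j →
    (iₛ iₜ : ℕ) →
    IsColMin n I iₛ j → (∀ k → IsColMin n I k j → iₛ ≤ k) →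
    IsColMin n I iₜ j → (∀ k → IsColMin n I k j → k ≤ iₜ) →
    (∀ j' → InR n j' → j' < j → ∃ λ k → k ≤ iₛ × IsColMin n I k j')
    × (∀ j'' → InR n j'' → j < j'' → ∃ λ k → iₜ ≤ k × IsColMin n I k j'')
claim3p4 n _ I _ j (h<j , _) iₛ iₜ iₛ-min _ iₜ-min _ =
  (λ j′ (h<j′ , _) j′<j → column-min-above {A = M n I} (M-monge n I h<j′ (<⇒≤ j′<j)) iₛ-min) ,
  (λ j″ _ j<j″ → column-min-below {A = M n I} (M-monge n I h<j (<⇒≤ j<j″)) iₜ-min)
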